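{- Let $q$ be an odd prime power. There exists a $(q+1)$-regular $(q+1)$-uniform minimal non-odd-bipartite hypergraph with $q^2+q+1$ edges. Moreover, for every integer $t>1$ there exists a $(q+1)$-regular $t(q+1)$-uniform minimal non-odd-bipartite hypergraph with $q^2+q+1$ edges.
   Context: A hypergraph has a finite vertex set and an edge set of distinct nonempty subsets, with no isolated vertices; it is $k$-uniform if every edge has $k$ vertices and $d$-regular if every vertex lies in exactly $d$ edges. For $k$ even, a $k$-uniform hypergraph $G$ is odd-bipartite if there is a bipartition $\{U,U^c\}$ of $V(G)$ such that every edge meets $U$ (and hence $U^c$) in an odd number of vertices; it is minimal non-odd-bipartite if it is not odd-bipartite but $G-e$ (delete the edge $e$ from the edge set) is odd-bipartite for every edge $e$. -}

module Defs where

open import Data.Nat using (ℕ; suc; _*_; _^_; _%_; _<_; _≤_)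
open import Data.Nat.Primality using (Prime)
open import Data.Fin using (Fin)
open import Data.Fin.Subset using (Subset; _∈_; _∩_; ∁; ∣_∣; Nonempty)
open import Data.Vec using (tabulate; lookup)
open import Data.Product using (Σ; ∃; _×_)
open import Data.Unit using (⊤)
open import Relation.Binary.PropositionalEquality using (_≡_; _≢_)
open import Function.Definitions using (Injective)

IsPrimePower : ℕ → Set
IsPrimePower q = Σ ℕ λ p → Σ ℕ λ m → Prime p × 1 ≤ m × q ≡ p ^ m

IsOddPrimePower : ℕ → Set
IsOddPrimePower q = IsPrimePower q × q % 2 ≡ 1

record Hypergraph : Set where
  field
    nV         : ℕ
    nE         : ℕ
    edge       : Fin nE → Subset nV
    distinct   : Injective _≡_ _≡_ edge
    nonempty   : ∀ e → Nonempty (edge e)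
    noIsolated : ∀ v → ∃ λ e → v ∈ edge e

open Hypergraph public

Uniform : Hypergraph → ℕ → Set
Uniform G k = ∀ e → ∣ edge G e ∣ ≡ k

degree : (G : Hypergraph) → Fin (nV G) → ℕ
degree G v = ∣ tabulate (λ e → lookup (edge G e) v) ∣

Regular : Hypergraph → ℕ → Set
Regular G d = ∀ v → degree G v ≡ d

Odd : ℕ → Set
Odd n = n % 2 ≡ 1

-- The sub-hypergraph of G (same vertex set) with edge set {edge e | P e} is
-- odd-bipartite: there is a bipartition {U, U^c} of V(G) (both parts nonempty)
-- such that every edge meets U in an odd number of vertices.
OddBipartiteOn : (G : Hypergraph) → (Fin (nE G) → Set) → Set
OddBipartiteOn G P =
  Σ (Subset (nV G)) λ U → Nonempty U × Nonempty (∁ U) ×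
    (∀ e → P e → Odd ∣ edge G e ∩ U ∣)

OddBipartite : Hypergraph → Set
OddBipartite G = OddBipartiteOn G (λ _ → ⊤)

OddBipartiteMinus : (G : Hypergraph) → Fin (nE G) → Set
OddBipartiteMinus G e = OddBipartiteOn G (λ e′ → e′ ≢ e)

MinimalNonOddBipartite : Hypergraph → Set
MinimalNonOddBipartite G =
  (OddBipartite G → Data.Empty.⊥) × (∀ e → OddBipartiteMinus G e)
  where import Data.Empty

-- The construction is cyclic rather than the paper's projective plane, so only the oddness of q
-- matters. Put N = qk + 1 and take as edges the N windows of k consecutive residues of ℤ_N, each
-- residue blown up into c vertices (one in each of c copies of ℤ_N). Every vertex lies in exactly
-- k windows, so for every U the sizes |e ∩ U| add up to k·|U|; for k = q + 1 even and N odd this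
-- cannot be a sum of N odd numbers. On the other hand {k, 2k, …, qk} ⊆ ℤ_N meets every window
-- exactly once except {0, …, k − 1}, which it misses; its translates inside one copy of ℤ_N show
-- that G − e is odd-bipartite for every edge e.

module Submission where

open import Defs
open import Data.Nat using (ℕ; zero; suc; _+_; _*_; _∸_; _<_; _≤_; s≤s; s≤s⁻¹; z<s; s<s; NonZero; ≢-nonZero⁻¹; >-nonZero⁻¹; _%_; _/_)
open import Data.Nat.Properties
open import Data.Nat.DivMod
open import Data.Nat.Divisibility using (∣-refl; m%n≡0⇒n∣m; n∣m⇒m%n≡0; ∣m⇒∣m*n; ∣n⇒∣m*n)
open import Data.Bool using (Bool; true; false; _∧_)
open import Data.Bool.Properties using (∧-identityʳ; ∧-zeroʳ; ∧-assoc; ∧-comm)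
open import Data.Fin using (Fin; zero; suc; toℕ; punchIn) renaming (_≟_ to _≟ᶠ_)
open import Data.Fin.Properties using (punchInᵢ≢i; toℕ<n; toℕ-injective)
open import Data.Fin.Subset using (Subset; _∈_; _∩_; ∁; ∣_∣; Nonempty)
open import Data.Fin.Subset.Properties
  using (nonempty?; Empty-unique; ∣⊥∣≡0; x∈p⇒∣p-x∣<∣p∣; x∈p∩q⁺; x∈p∩q⁻; x∉p⇒x∈∁p; _∈?_)
open import Data.Vec using (_∷_; []; tabulate; lookup)
open import Data.Vec.Properties using (tabulate-cong; lookup∘tabulate; lookup-zipWith; []=⇒lookup; lookup⇒[]=)
open import Data.Product using (∃; _×_; _,_; proj₂)
open import Data.Unit using (tt)
open import Algebra.Properties.CommutativeSemigroup +-commutativeSemigroup using (interchange)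
open import Algebra.Properties.Semiring.Sum +-*-semiring using (sum; ∑-comm; *-distribʳ-sum; *-distribˡ-sum; sum-cong-≗)
open import Function using (_∘_)
open import Function.Definitions using (Injective)
open import Relation.Nullary using (does; yes; no; ¬_; contradiction)
open import Relation.Nullary.Decidable using (dec-true; dec-false)
open import Relation.Binary.PropositionalEquality
open ≡-Reasoning

indicator : Bool → ℕ
indicator true  = 1
indicator false = 0

count : (ℕ → Bool) → ℕ → ℕ
count f zero    = 0
count f (suc n) = indicator (f 0) + count (f ∘ suc) n

count-cong : ∀ n {f g : ℕ → Bool} → (∀ x → x < n → f x ≡ g x) → count f n ≡ count g n
count-cong zero    f≗g = refl
count-cong (suc n) f≗g =
  cong₂ _+_ (cong indicator (f≗g 0 z<s)) (count-cong n (λ x x<n → f≗g (suc x) (s<s x<n)))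

count-false : ∀ n (f : ℕ → Bool) → (∀ x → x < n → f x ≡ false) → count f n ≡ 0
count-false zero    f f≡false = refl
count-false (suc n) f f≡false rewrite f≡false 0 z<s =
  count-false n (f ∘ suc) (λ x x<n → f≡false (suc x) (s<s x<n))

count-true : ∀ n → count (λ _ → true) n ≡ n
count-true zero    = refl
count-true (suc n) = cong suc (count-true n)

count-+ : ∀ m n (f : ℕ → Bool) → count f (m + n) ≡ count f m + count (λ x → f (m + x)) n
count-+ zero    n f = refl
count-+ (suc m) n f =
  trans (cong (indicator (f 0) +_) (count-+ m n (f ∘ suc))) (sym (+-assoc (indicator (f 0)) _ _))

count-periodic : ∀ c n (f : ℕ → Bool) → (∀ x → f (n + x) ≡ f x) → count f (c * n) ≡ c * count f n
count-periodic zero    n f periodic = refl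
count-periodic (suc c) n f periodic = begin
  count f (n + c * n)                         ≡⟨ count-+ n (c * n) f ⟩
  count f n + count (λ x → f (n + x)) (c * n) ≡⟨ cong (count f n +_) (count-cong (c * n) (λ x _ → periodic x)) ⟩
  count f n + count f (c * n)                 ≡⟨ cong (count f n +_) (count-periodic c n f periodic) ⟩
  count f n + c * count f n                   ∎

count-restrict : ∀ {m n} (f : ℕ → Bool) → m ≤ n → count (λ x → f x ∧ does (x <? m)) n ≡ count f m
count-restrict {m} {n} f m≤n = begin
  count g n                                         ≡⟨ cong (count g) (sym (m+[n∸m]≡n m≤n)) ⟩
  count g (m + (n ∸ m))                             ≡⟨ count-+ m (n ∸ m) g ⟩
  count g m + count (λ x → g (m + x)) (n ∸ m)       ≡⟨ cong₂ _+_ (count-cong m below) (count-false (n ∸ m) _ above) ⟩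
  count f m + 0                                     ≡⟨ +-identityʳ _ ⟩
  count f m                                         ∎
  where
  g : ℕ → Bool
  g x = f x ∧ does (x <? m)
  below : ∀ x → x < m → g x ≡ f x
  below x x<m = trans (cong (f x ∧_) (dec-true (x <? m) x<m)) (∧-identityʳ (f x))
  above : ∀ x → x < n ∸ m → g (m + x) ≡ false
  above x _ = trans (cong (f (m + x) ∧_) (dec-false (m + x <? m) (≤⇒≯ (m≤m+n m x)))) (∧-zeroʳ _)

[m+n%d]%d≡[m+n]%d : ∀ m n d .{{_ : NonZero d}} → (m + n % d) % d ≡ (m + n) % d
[m+n%d]%d≡[m+n]%d m n d = begin
  (m + n % d) % d                 ≡⟨ sym ([m+kn]%n≡m%n (m + n % d) (n / d) d) ⟩
  (m + n % d + n / d * d) % d     ≡⟨ cong (_% d) (+-assoc m (n % d) (n / d * d)) ⟩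
  (m + (n % d + n / d * d)) % d   ≡⟨ cong (λ x → (m + x) % d) (sym (m≡m%n+[m/n]*n n d)) ⟩
  (m + n) % d                     ∎

[m%d+n]%d≡[m+n]%d : ∀ m n d .{{_ : NonZero d}} → (m % d + n) % d ≡ (m + n) % d
[m%d+n]%d≡[m+n]%d m n d = begin
  (m % d + n) % d ≡⟨ cong (_% d) (+-comm (m % d) n) ⟩
  (n + m % d) % d ≡⟨ [m+n%d]%d≡[m+n]%d n m d ⟩
  (n + m) % d     ≡⟨ cong (_% d) (+-comm n m) ⟩
  (m + n) % d     ∎

count-rotate-≤ : ∀ n .{{_ : NonZero n}} r (g : ℕ → Bool) → r ≤ n →
                 count (λ x → g ((x + r) % n)) n ≡ count g n
count-rotate-≤ n r g r≤n = begin
  count h n                                   ≡⟨ cong (count h) (sym d+r≡n) ⟩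
  count h (d + r)                             ≡⟨ count-+ d r h ⟩
  count h d + count (λ x → h (d + x)) r       ≡⟨ cong₂ _+_ (count-cong d unwrapped) (count-cong r wrapped) ⟩
  count (λ x → g (r + x)) d + count g r       ≡⟨ +-comm _ (count g r) ⟩
  count g r + count (λ x → g (r + x)) d       ≡⟨ sym (count-+ r d g) ⟩
  count g (r + d)                             ≡⟨ cong (count g) (m+[n∸m]≡n r≤n) ⟩
  count g n                                   ∎
  where
  h : ℕ → Bool
  h x = g ((x + r) % n)
  d = n ∸ r
  d+r≡n : d + r ≡ n
  d+r≡n = m∸n+n≡m r≤n
  unwrapped : ∀ x → x < d → h x ≡ g (r + x)
  unwrapped x x<d =
    cong g (trans (m<n⇒m%n≡m (subst (x + r <_) d+r≡n (+-monoˡ-< r x<d))) (+-comm x r))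
  wrapped : ∀ x → x < r → h (d + x) ≡ g x
  wrapped x x<r = cong g (begin
    (d + x + r) % n   ≡⟨ cong (_% n) (trans (+-assoc d x r) (cong (d +_) (+-comm x r))) ⟩
    (d + (r + x)) % n ≡⟨ cong (_% n) (trans (sym (+-assoc d r x)) (cong (_+ x) d+r≡n)) ⟩
    (n + x) % n       ≡⟨ %-remove-+ˡ x ∣-refl ⟩
    x % n             ≡⟨ m<n⇒m%n≡m (<-≤-trans x<r r≤n) ⟩
    x                 ∎)

count-rotate : ∀ n .{{_ : NonZero n}} r (g : ℕ → Bool) →
               count (λ x → g ((x + r) % n)) n ≡ count g n
count-rotate n r g = trans
  (count-cong n (λ x _ → cong g (sym ([m+n%d]%d≡[m+n]%d x r n))))
  (count-rotate-≤ n (r % n) g (m%n≤n r n))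

∣b∷p∣ : ∀ {n} b (p : Subset n) → ∣ b ∷ p ∣ ≡ indicator b + ∣ p ∣
∣b∷p∣ true  p = refl
∣b∷p∣ false p = refl

∣tabulate∣≡count : ∀ n (f : ℕ → Bool) → ∣ tabulate {n = n} (f ∘ toℕ) ∣ ≡ count f n
∣tabulate∣≡count zero    f = refl
∣tabulate∣≡count (suc n) f = trans (∣b∷p∣ (f 0) (tabulate {n = n} (f ∘ suc ∘ toℕ)))
  (cong (indicator (f 0) +_) (∣tabulate∣≡count n (f ∘ suc)))

tabulate-∩ : ∀ {n} (f g : Fin n → Bool) → tabulate f ∩ tabulate g ≡ tabulate (λ i → f i ∧ g i)
tabulate-∩ {zero}  f g = refl
tabulate-∩ {suc n} f g = cong (f zero ∧ g zero ∷_) (tabulate-∩ (f ∘ suc) (g ∘ suc))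

∣p∣≡∑indicator : ∀ {n} (p : Subset n) → ∣ p ∣ ≡ sum (indicator ∘ lookup p)
∣p∣≡∑indicator []      = refl
∣p∣≡∑indicator (b ∷ p) = trans (∣b∷p∣ b p) (cong (indicator b +_) (∣p∣≡∑indicator p))

∣p∣≢0⇒Nonempty : ∀ {n} (p : Subset n) → ∣ p ∣ ≢ 0 → Nonempty p
∣p∣≢0⇒Nonempty {n} p ∣p∣≢0 with nonempty? p
... | yes p≠∅ = p≠∅
... | no  p≡∅ = contradiction (trans (cong ∣_∣ (Empty-unique p≡∅)) (∣⊥∣≡0 n)) ∣p∣≢0

x∈p⇒∣p∣≢0 : ∀ {n} {x : Fin n} {p : Subset n} → x ∈ p → ∣ p ∣ ≢ 0
x∈p⇒∣p∣≢0 x∈p = n>0⇒n≢0 (<-≤-trans z<s (x∈p⇒∣p-x∣<∣p∣ x∈p))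

positive-degree⇒incident : ∀ {m n} (E : Fin m → Subset n) (v : Fin n) →
  ∣ tabulate (λ e → lookup (E e) v) ∣ ≢ 0 → ∃ λ e → v ∈ E e
positive-degree⇒incident E v degree≢0 with ∣p∣≢0⇒Nonempty (tabulate (λ e → lookup (E e) v)) degree≢0
... | e , e∈ = e , lookup⇒[]= v (E e)
  (trans (sym (lookup∘tabulate (λ e → lookup (E e) v) e)) ([]=⇒lookup e∈))

indicator-∧ : ∀ a b → indicator (a ∧ b) ≡ indicator a * indicator b
indicator-∧ true  true  = refl
indicator-∧ true  false = refl
indicator-∧ false b     = refl

degree≡∑indicator : (G : Hypergraph) (v : Fin (nV G)) →
  degree G v ≡ sum (λ e → indicator (lookup (edge G e) v))
degree≡∑indicator G v = trans (∣p∣≡∑indicator (tabulate (λ e → lookup (edge G e) v)))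
  (sum-cong-≗ (λ e → cong indicator (lookup∘tabulate (λ e → lookup (edge G e) v) e)))

∑∣edge∩U∣≡∑degree : (G : Hypergraph) (U : Subset (nV G)) →
  sum (λ e → ∣ edge G e ∩ U ∣) ≡ sum (λ v → degree G v * indicator (lookup U v))
∑∣edge∩U∣≡∑degree G U = begin
  sum (λ e → ∣ E e ∩ U ∣)
    ≡⟨ sum-cong-≗ (λ e → trans (∣p∣≡∑indicator (E e ∩ U)) (sum-cong-≗ (incidence e))) ⟩
  sum (λ e → sum (λ v → indicator (lookup (E e) v) * indicator (lookup U v)))
    ≡⟨ ∑-comm (λ e v → indicator (lookup (E e) v) * indicator (lookup U v)) ⟩
  sum (λ v → sum (λ e → indicator (lookup (E e) v) * indicator (lookup U v)))
    ≡⟨ sum-cong-≗ (λ v → sym (*-distribʳ-sum (indicator (lookup U v)) (λ e → indicator (lookup (E e) v)))) ⟩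
  sum (λ v → sum (λ e → indicator (lookup (E e) v)) * indicator (lookup U v))
    ≡⟨ sum-cong-≗ (λ v → cong (_* indicator (lookup U v)) (sym (degree≡∑indicator G v))) ⟩
  sum (λ v → degree G v * indicator (lookup U v)) ∎
  where
  E = edge G
  incidence : ∀ e v → indicator (lookup (E e ∩ U) v) ≡ indicator (lookup (E e) v) * indicator (lookup U v)
  incidence e v = trans (cong indicator (lookup-zipWith _∧_ v (E e) U)) (indicator-∧ (lookup (E e) v) (lookup U v))

regular⇒∑∣edge∩U∣≡d*∣U∣ : ∀ G {d} → Regular G d → (U : Subset (nV G)) →
  sum (λ e → ∣ edge G e ∩ U ∣) ≡ d * ∣ U ∣
regular⇒∑∣edge∩U∣≡d*∣U∣ G {d} regular U = begin
  sum (λ e → ∣ edge G e ∩ U ∣)                      ≡⟨ ∑∣edge∩U∣≡∑degree G U ⟩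
  sum (λ v → degree G v * indicator (lookup U v))   ≡⟨ sum-cong-≗ (λ v → cong (_* indicator (lookup U v)) (regular v)) ⟩
  sum (λ v → d * indicator (lookup U v))            ≡⟨ sym (*-distribˡ-sum d (indicator ∘ lookup U)) ⟩
  d * sum (indicator ∘ lookup U)                    ≡⟨ cong (d *_) (sym (∣p∣≡∑indicator U)) ⟩
  d * ∣ U ∣                                         ∎

∑-odd : ∀ {n} (f : Fin n → ℕ) → (∀ i → Odd (f i)) → sum f % 2 ≡ n % 2
∑-odd {zero}  f odd = refl
∑-odd {suc n} f odd = begin
  (f zero + sum (f ∘ suc)) % 2             ≡⟨ %-distribˡ-+ (f zero) (sum (f ∘ suc)) 2 ⟩
  (f zero % 2 + sum (f ∘ suc) % 2) % 2     ≡⟨ cong₂ (λ a b → (a + b) % 2) (odd zero) (∑-odd (f ∘ suc) (odd ∘ suc)) ⟩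
  (1 + n % 2) % 2                          ≡⟨ [m+n%d]%d≡[m+n]%d 1 n 2 ⟩
  suc n % 2                                ∎

regular⇒¬OddBipartite : ∀ G {d} → Regular G d → d % 2 ≡ 0 → Odd (nE G) → ¬ OddBipartite G
regular⇒¬OddBipartite G {d} regular d-even edges-odd (U , _ , _ , meets-odd) = 1+n≢0 (begin
  1                                    ≡⟨ sym edges-odd ⟩
  nE G % 2                             ≡⟨ sym (∑-odd (λ e → ∣ edge G e ∩ U ∣) (λ e → meets-odd e tt)) ⟩
  sum (λ e → ∣ edge G e ∩ U ∣) % 2     ≡⟨ cong (_% 2) (regular⇒∑∣edge∩U∣≡d*∣U∣ G regular U) ⟩
  d * ∣ U ∣ % 2                        ≡⟨ n∣m⇒m%n≡0 (d * ∣ U ∣) 2 (∣m⇒∣m*n ∣ U ∣ (m%n≡0⇒n∣m d 2 d-even)) ⟩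
  0                                    ∎)

record Separators {m n} (E : Fin m → Subset n) : Set where
  field
    separator  : Fin m → Subset n
    misses     : ∀ e → ∣ E e ∩ separator e ∣ ≡ 0
    meets-once : ∀ {i e} → i ≢ e → ∣ E i ∩ separator e ∣ ≡ 1

module _ {m n} {E : Fin m → Subset n} (S : Separators E) where
  open Separators S

  separators⇒injective : Injective _≡_ _≡_ E
  separators⇒injective {i} {e} Ei≡Ee with i ≟ᶠ e
  ... | yes i≡e = i≡e
  ... | no  i≢e = contradiction
    (trans (sym (meets-once i≢e)) (trans (cong (λ p → ∣ p ∩ separator e ∣) Ei≡Ee) (misses e))) 1+n≢0

another : ∀ {m} → 1 < m → (e : Fin m) → ∃ λ i → i ≢ e
another {suc (suc m)} _          e = punchIn e zero , punchInᵢ≢i e zero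
another {suc zero}    (s≤s ())   e

separators⇒oddBipartiteMinus : (G : Hypergraph) → Separators (edge G) → 1 < nE G →
  ∀ e → OddBipartiteMinus G e
separators⇒oddBipartiteMinus G S 1<m e = U , U≠∅ , ∁U≠∅ , meets-odd
  where
  open Separators S
  U = separator e
  U≠∅ : Nonempty U
  U≠∅ with another 1<m e
  ... | i , i≢e with ∣p∣≢0⇒Nonempty (edge G i ∩ U) (λ ∣Ei∩U∣≡0 → 1+n≢0 (trans (sym (meets-once i≢e)) ∣Ei∩U∣≡0))
  ... | x , x∈Ei∩U = x , proj₂ (x∈p∩q⁻ (edge G i) U x∈Ei∩U)
  ∁U≠∅ : Nonempty (∁ U)
  ∁U≠∅ with nonempty G e
  ... | x , x∈Ee with x ∈? U
  ... | yes x∈U = contradiction (misses e) (x∈p⇒∣p∣≢0 (x∈p∩q⁺ (x∈Ee , x∈U)))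
  ... | no  x∉U = x , x∉p⇒x∈∁p x∉U
  meets-odd : ∀ i → i ≢ e → Odd ∣ edge G i ∩ U ∣
  meets-odd i i≢e = subst Odd (sym (meets-once i≢e)) refl

[e+[n∸i]]%n≡0⇒i≡e : ∀ {n i e} .{{_ : NonZero n}} → i < n → e < n → (e + (n ∸ i)) % n ≡ 0 → i ≡ e
[e+[n∸i]]%n≡0⇒i≡e {n} {i} {e} i<n e<n ≡0 with i ≤? e
... | yes i≤e = ≤-antisym i≤e (m∸n≡0⇒m≤n (begin
  e ∸ i                       ≡⟨ sym (m<n⇒m%n≡m (≤-<-trans (m∸n≤m e i) e<n)) ⟩
  (e ∸ i) % n                 ≡⟨ sym (%-remove-+ʳ (e ∸ i) ∣-refl) ⟩
  (e ∸ i + n) % n             ≡⟨ cong (λ x → (e ∸ i + x) % n) (sym (m+[n∸m]≡n (<⇒≤ i<n))) ⟩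
  (e ∸ i + (i + (n ∸ i))) % n ≡⟨ cong (_% n) (sym (+-assoc (e ∸ i) i (n ∸ i))) ⟩
  (e ∸ i + i + (n ∸ i)) % n   ≡⟨ cong (λ x → (x + (n ∸ i)) % n) (m∸n+n≡m i≤e) ⟩
  (e + (n ∸ i)) % n           ≡⟨ ≡0 ⟩
  0                           ∎))
... | no  i≰e = contradiction (m∸n≡0⇒m≤n n∸i≡0) (<⇒≱ i<n)
  where
  e+[n∸i]<n : e + (n ∸ i) < n
  e+[n∸i]<n = subst (e + (n ∸ i) <_) (m+[n∸m]≡n (<⇒≤ i<n)) (+-monoˡ-< (n ∸ i) (≰⇒> i≰e))
  n∸i≡0 : n ∸ i ≡ 0
  n∸i≡0 = m+n≡0⇒n≡0 e (trans (sym (m<n⇒m%n≡m e+[n∸i]<n)) ≡0)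

between-multiples⇒%≢0 : ∀ {q k n} .{{_ : NonZero k}} → q * k < n → n < suc q * k → n % k ≢ 0
between-multiples⇒%≢0 {q} {k} {n} lower upper n%k≡0 = <⇒≱ q<n/k (s≤s⁻¹ n/k<1+q)
  where
  n≡n/k*k : n ≡ n / k * k
  n≡n/k*k = trans (m≡m%n+[m/n]*n n k) (cong (_+ n / k * k) n%k≡0)
  q<n/k : q < n / k
  q<n/k = *-cancelʳ-< k q (n / k) (subst (q * k <_) n≡n/k*k lower)
  n/k<1+q : n / k < suc q
  n/k<1+q = *-cancelʳ-< k (n / k) (suc q) (subst (_< suc q * k) n≡n/k*k upper)

count-≟0 : ∀ n → 0 < n → count (λ y → does (y ≟ 0)) n ≡ 1
count-≟0 (suc n) _ = cong suc (count-false n (λ y → does (suc y ≟ 0)) (λ _ _ → refl))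

module Cyclic (q k c : ℕ) .{{_ : NonZero q}} .{{_ : NonZero k}} .{{_ : NonZero c}} where

  N : ℕ
  N = suc (q * k)

  inWindow : ℕ → ℕ → Bool
  inWindow i v = does ((v + i) % N <? k)

  isMark : ℕ → Bool
  isMark y = does (0 <? y) ∧ does (y % k ≟ 0)

  inSeparator : ℕ → ℕ → Bool
  inSeparator e v = isMark ((v + e) % N) ∧ does (v <? N)

  k≤N : k ≤ N
  k≤N = m≤n⇒m≤1+n (m≤n*m k q)

  count-<k : count (λ w → does (w <? k)) N ≡ k
  count-<k = trans (count-restrict (λ _ → true) k≤N) (count-true k)

  count-window : ∀ i → count (inWindow i) (c * N) ≡ c * k
  count-window i = trans (count-periodic c N (inWindow i) periodic)
    (cong (c *_) (trans (count-rotate N i (λ w → does (w <? k))) count-<k))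
    where
    periodic : ∀ x → inWindow i (N + x) ≡ inWindow i x
    periodic x = cong (λ y → does (y <? k))
      (trans (cong (_% N) (+-assoc N x i)) (%-remove-+ˡ (x + i) ∣-refl))

  count-windows∋ : ∀ v → count (λ i → inWindow i v) N ≡ k
  count-windows∋ v = trans (count-cong N (λ i _ → cong (λ x → does (x % N <? k)) (+-comm v i)))
    (trans (count-rotate N v (λ w → does (w <? k))) count-<k)

  isMark-< : ∀ {y} → y < k → isMark y ≡ false
  isMark-< {zero}  _   = refl
  isMark-< {suc y} y<k = dec-false (suc y % k ≟ 0) (λ ≡0 → 1+n≢0 (trans (sym (m<n⇒m%n≡m y<k)) ≡0))

  isMark-window : ∀ {m z} → 0 < m → m < N → z < k → isMark ((z + m) % N) ≡ does ((z + m) % k ≟ 0)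
  isMark-window {m} {z} 0<m m<N z<k with z + m <? N
  ... | yes s<N = begin
    isMark ((z + m) % N)   ≡⟨ cong isMark (m<n⇒m%n≡m s<N) ⟩
    isMark (z + m)         ≡⟨ cong (_∧ does ((z + m) % k ≟ 0)) (dec-true (0 <? z + m) (<-≤-trans 0<m (m≤n+m m z))) ⟩
    does ((z + m) % k ≟ 0) ∎
  ... | no  s≮N = begin
    isMark ((z + m) % N)     ≡⟨ cong isMark (sym (m≤n⇒[n∸m]%m≡n%m N≤s)) ⟩
    isMark ((z + m ∸ N) % N) ≡⟨ cong isMark (m<n⇒m%n≡m (<-≤-trans s∸N<k k≤N)) ⟩
    isMark (z + m ∸ N)       ≡⟨ isMark-< s∸N<k ⟩
    false                    ≡⟨ sym (dec-false ((z + m) % k ≟ 0) (between-multiples⇒%≢0 {q} N≤s s<[1+q]*k)) ⟩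
    does ((z + m) % k ≟ 0)   ∎
    where
    N≤s : N ≤ z + m
    N≤s = ≮⇒≥ s≮N
    s<[1+q]*k : z + m < suc q * k
    s<[1+q]*k = +-mono-<-≤ z<k (s≤s⁻¹ m<N)
    s∸N<k : z + m ∸ N < k
    s∸N<k = m<n+o⇒m∸n<o (z + m) N (subst (z + m <_) (+-comm k N) (+-mono-< z<k m<N))

  count-marks : ∀ {m} → 0 < m → m < N → count (λ z → isMark ((z + m) % N)) k ≡ 1
  count-marks {m} 0<m m<N = begin
    count (λ z → isMark ((z + m) % N)) k     ≡⟨ count-cong k (λ z z<k → isMark-window 0<m m<N z<k) ⟩
    count (λ z → does ((z + m) % k ≟ 0)) k   ≡⟨ count-rotate k m (λ y → does (y ≟ 0)) ⟩
    count (λ y → does (y ≟ 0)) k             ≡⟨ count-≟0 k (>-nonZero⁻¹ k) ⟩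
    1                                        ∎

  -- e − i modulo N, written without truncated subtraction
  shift : ℕ → ℕ → ℕ
  shift i e = e + (N ∸ i)

  shift-spec : ∀ v {i} e → i ≤ N → ((v + i) % N + shift i e) % N ≡ (v + e) % N
  shift-spec v {i} e i≤N = begin
    ((v + i) % N + shift i e) % N   ≡⟨ [m%d+n]%d≡[m+n]%d (v + i) (shift i e) N ⟩
    (v + i + (e + (N ∸ i))) % N     ≡⟨ cong (_% N) (interchange v i e (N ∸ i)) ⟩
    (v + e + (i + (N ∸ i))) % N     ≡⟨ cong (λ x → (v + e + x) % N) (m+[n∸m]≡n i≤N) ⟩
    (v + e + N) % N                 ≡⟨ %-remove-+ʳ (v + e) ∣-refl ⟩
    (v + e) % N                     ∎

  count-window∩separator : ∀ {i} e → i ≤ N →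
    count (λ v → inWindow i v ∧ inSeparator e v) (c * N) ≡ count (λ z → isMark ((z + shift i e) % N)) k
  count-window∩separator {i} e i≤N = begin
    count (λ v → inWindow i v ∧ inSeparator e v) (c * N)
      ≡⟨ count-cong (c * N) (λ v _ → sym (∧-assoc (inWindow i v) (isMark ((v + e) % N)) (does (v <? N)))) ⟩
    count (λ v → (inWindow i v ∧ isMark ((v + e) % N)) ∧ does (v <? N)) (c * N)
      ≡⟨ count-restrict (λ v → inWindow i v ∧ isMark ((v + e) % N)) (m≤n*m N c) ⟩
    count (λ v → inWindow i v ∧ isMark ((v + e) % N)) N
      ≡⟨ count-cong N (λ v _ → trans (∧-comm (inWindow i v) _) (cong (λ x → isMark x ∧ inWindow i v) (sym (shift-spec v e i≤N)))) ⟩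
    count (λ v → G ((v + i) % N)) N ≡⟨ count-rotate N i G ⟩
    count G N                       ≡⟨ count-restrict (λ z → isMark ((z + shift i e) % N)) k≤N ⟩
    count (λ z → isMark ((z + shift i e) % N)) k ∎
    where
    G : ℕ → Bool
    G w = isMark ((w + shift i e) % N) ∧ does (w <? k)

  count-window∩separator-self : ∀ e → e ≤ N → count (λ v → inWindow e v ∧ inSeparator e v) (c * N) ≡ 0
  count-window∩separator-self e e≤N = trans (count-window∩separator e e≤N) (count-false k _ unmarked)
    where
    unmarked : ∀ z → z < k → isMark ((z + shift e e) % N) ≡ false
    unmarked z z<k = trans
      (cong (λ x → isMark ((z + x) % N)) (m+[n∸m]≡n e≤N))
      (trans (cong isMark (trans (%-remove-+ʳ z ∣-refl) (m<n⇒m%n≡m (<-≤-trans z<k k≤N)))) (isMark-< z<k))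

  count-window∩separator-other : ∀ {i e} → i < N → e < N → i ≢ e →
    count (λ v → inWindow i v ∧ inSeparator e v) (c * N) ≡ 1
  count-window∩separator-other {i} {e} i<N e<N i≢e = begin
    count (λ v → inWindow i v ∧ inSeparator e v) (c * N)
      ≡⟨ count-window∩separator e (<⇒≤ i<N) ⟩
    count (λ z → isMark ((z + shift i e) % N)) k
      ≡⟨ count-cong k (λ z _ → cong isMark (sym ([m+n%d]%d≡[m+n]%d z (shift i e) N))) ⟩
    count (λ z → isMark ((z + shift i e % N) % N)) k
      ≡⟨ count-marks (n≢0⇒n>0 (i≢e ∘ [e+[n∸i]]%n≡0⇒i≡e i<N e<N)) (m%n<n (shift i e) N) ⟩
    1 ∎

  window : Fin N → Subset (c * N)
  window i = tabulate (inWindow (toℕ i) ∘ toℕ)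

  separator : Fin N → Subset (c * N)
  separator e = tabulate (inSeparator (toℕ e) ∘ toℕ)

  ∣window∩separator∣ : ∀ (i e : Fin N) →
    ∣ window i ∩ separator e ∣ ≡ count (λ v → inWindow (toℕ i) v ∧ inSeparator (toℕ e) v) (c * N)
  ∣window∩separator∣ i e = trans
    (cong (∣_∣ {c * N}) (tabulate-∩ (inWindow (toℕ i) ∘ toℕ) (inSeparator (toℕ e) ∘ toℕ)))
    (∣tabulate∣≡count (c * N) (λ v → inWindow (toℕ i) v ∧ inSeparator (toℕ e) v))

  separators : Separators window
  separators = record
    { separator  = separator
    ; misses     = λ e → trans (∣window∩separator∣ e e)
        (count-window∩separator-self (toℕ e) (<⇒≤ (toℕ<n e)))
    ; meets-once = λ {i} {e} i≢e → trans (∣window∩separator∣ i e)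
        (count-window∩separator-other (toℕ<n i) (toℕ<n e) (i≢e ∘ toℕ-injective))
    }

  ∣window∣ : ∀ (i : Fin N) → ∣ window i ∣ ≡ c * k
  ∣window∣ i = trans (∣tabulate∣≡count (c * N) (inWindow (toℕ i))) (count-window (toℕ i))

  degree-window : ∀ (v : Fin (c * N)) → ∣ tabulate (λ i → lookup (window i) v) ∣ ≡ k
  degree-window v = begin
    ∣ tabulate (λ i → lookup (window i) v) ∣
      ≡⟨ cong ∣_∣ (tabulate-cong {n = N} (λ i → lookup∘tabulate (inWindow (toℕ i) ∘ toℕ) v)) ⟩
    ∣ tabulate {n = N} ((λ i → inWindow i (toℕ v)) ∘ toℕ) ∣ ≡⟨ ∣tabulate∣≡count N (λ i → inWindow i (toℕ v)) ⟩
    count (λ i → inWindow i (toℕ v)) N                      ≡⟨ count-windows∋ (toℕ v) ⟩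
    k                                                       ∎

  hypergraph : Hypergraph
  hypergraph = record
    { nV         = c * N
    ; nE         = N
    ; edge       = window
    ; distinct   = separators⇒injective separators
    ; nonempty   = λ i → ∣p∣≢0⇒Nonempty (window i)
                     (subst (_≢ 0) (sym (∣window∣ i)) (≢-nonZero⁻¹ (c * k) {{m*n≢0 c k}}))
    ; noIsolated = λ v → positive-degree⇒incident window v
                     (subst (_≢ 0) (sym (degree-window v)) (≢-nonZero⁻¹ k))
    }

  N-odd : k % 2 ≡ 0 → Odd N
  N-odd k-even = trans (sym ([m+n%d]%d≡[m+n]%d 1 (q * k) 2))
    (cong (λ x → (1 + x) % 2) (n∣m⇒m%n≡0 (q * k) 2 (∣n⇒∣m*n q (m%n≡0⇒n∣m k 2 k-even))))

  1<N : 1 < N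
  1<N = s<s (>-nonZero⁻¹ (q * k) {{m*n≢0 q k}})

minimalNonOddBipartite-cyclic : ∀ q k c .{{_ : NonZero q}} .{{_ : NonZero k}} .{{_ : NonZero c}} →
  k % 2 ≡ 0 →
  ∃ λ G → Regular G k × Uniform G (c * k) × MinimalNonOddBipartite G × nE G ≡ suc (q * k)
minimalNonOddBipartite-cyclic q k c k-even =
  hypergraph , degree-window , ∣window∣ ,
  (regular⇒¬OddBipartite hypergraph degree-window k-even (N-odd k-even) ,
   separators⇒oddBipartiteMinus hypergraph separators 1<N) ,
  refl
  where open Cyclic q k c

corollary4p12 : (q : ℕ) → IsOddPrimePower q →
    (∃ λ G → Regular G (suc q) × Uniform G (suc q) × MinimalNonOddBipartite G × nE G ≡ q * q + q + 1)
    × ((t : ℕ) → 1 < t →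
      ∃ λ G → Regular G (suc q) × Uniform G (t * suc q) × MinimalNonOddBipartite G × nE G ≡ q * q + q + 1)
corollary4p12 zero    (_ , ())
corollary4p12 (suc q) (_ , q-odd) =
  (let G , regular , uniform , minimal , edges = cyclic 1
   in G , regular , (λ e → trans (uniform e) (*-identityˡ _)) , minimal , edges) ,
  λ { (suc t) _ → cyclic (suc t) }
  where
  q+1-even : suc (suc q) % 2 ≡ 0
  q+1-even = trans (sym ([m+n%d]%d≡[m+n]%d 1 (suc q) 2)) (cong (λ x → (1 + x) % 2) q-odd)
  edges : suc (suc q * suc (suc q)) ≡ suc q * suc q + suc q + 1
  edges = trans (cong suc (trans (*-suc (suc q) (suc q)) (+-comm (suc q) _))) (+-comm 1 _)
  cyclic : ∀ c .{{_ : NonZero c}} → ∃ λ G → Regular G (suc (suc q)) × Uniform G (c * suc (suc q))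
                                      × MinimalNonOddBipartite G × nE G ≡ suc q * suc q + suc q + 1
  cyclic c = let G , regular , uniform , minimal , N≡ = minimalNonOddBipartite-cyclic (suc q) (suc (suc q)) c q+1-even
             in G , regular , uniform , minimal , trans N≡ edges
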